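{- Let $\bar{x}\in X$ be a feasible solution of $\Pi$ and let $b=(b_1,\dots,b_p)$ be such that $b_j\leq f_j(\bar{x})\leq (1+\varepsilon)\cdot b_j$ for $j=1,\dots,p$ and some $\varepsilon>0$. Applying $\textnormal{WS}_{\sigma}(w)$ with $w_j:=\frac{1}{b_j}$ for $j=1,\dots,p$ yields a solution $\hat x$ that $(\alpha_1,\dots,\alpha_p)$-approximates $\bar x$ for some $\alpha_1,\dots,\alpha_p\geq1$ such that $\alpha_i \leq \sigma$ for at least one $i \in \{1,\ldots,p\}$ and \begin{align*} \sum_{j:\alpha_j>1} \alpha_j = (1+\varepsilon)\cdot\sigma\cdot p. \end{align*}
   Context: $\Pi$ is a multiobjective minimization problem $\min f(x)=(f_1(x),\dots,f_p(x))$ s.t. $x\in X$, with a constant number $p\geq 2$ of objectives, nonempty feasible set $X$, and objective functions taking only positive rational values. For a positive weight vector $w\in\mathbb{R}^p$, the weighted sum problem is $\min \sum_{j=1}^p w_j f_j(x)$ s.t. $x\in X$. $\textnormal{WS}_{\sigma}$ is a polynomial-time $\sigma$-approximation algorithm ($\sigma\geq 1$) for the weighted sum problem: called with weight vector $w$, denoted $\textnormal{WS}_{\sigma}(w)$, it returns $\hat x\in X$ with $\sum_{j=1}^p w_j f_j(\hat x)\leq \sigma\sum_{j=1}^p w_j f_j(x)$ for all $x\in X$. For $\alpha=(\alpha_1,\dots,\alpha_p)$ with all $\alpha_j\geq 1$, a solution $x$ $\alpha$-approximates $x'$ if $f_j(x)\leq \alpha_j f_j(x')$ for all $j$. -}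

module Defs where

open import Data.Nat using (ℕ; zero; suc)
import Data.Integer
import Data.Rational
open import Data.Fin using (Fin; zero; suc)
open import Data.Rational using (ℚ; 0ℚ; 1ℚ; _+_; _*_; _≤_; _<_; 1/_; positive)
open import Data.Rational.Properties using (pos⇒nonZero; _<?_)
open import Relation.Nullary using (yes; no)

sumFin : (p : ℕ) → (Fin p → ℚ) → ℚ
sumFin zero    g = 0ℚ
sumFin (suc p) g = g zero + sumFin p (λ j → g (suc j))

sumOver>1 : (p : ℕ) → (Fin p → ℚ) → ℚ
sumOver>1 p α = sumFin p (λ j → term (α j))
  where
  term : ℚ → ℚ
  term a with 1ℚ <? a
  ... | yes _ = a
  ... | no  _ = 0ℚ

recip : (q : ℚ) → 0ℚ < q → ℚ
recip q h = 1/_ q {{pos⇒nonZero q {{positive h}}}}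

weightedSum : {X : Set} (p : ℕ) → (X → Fin p → ℚ) → (Fin p → ℚ) → X → ℚ
weightedSum p f w x = sumFin p (λ j → w j * f x j)

IsWSApprox : {X : Set} (p : ℕ) → (X → Fin p → ℚ) → ℚ → ((Fin p → ℚ) → X) → Set
IsWSApprox {X} p f σ WS =
  (w : Fin p → ℚ) → (∀ j → 0ℚ < w j) →
  (x : X) → weightedSum p f w (WS w) ≤ σ * weightedSum p f w x

Approximates : {X : Set} (p : ℕ) → (X → Fin p → ℚ) → (Fin p → ℚ) → X → X → Set
Approximates p f α x x' = ∀ j → f x j ≤ α j * f x' j

ℕtoℚ : ℕ → ℚ
ℕtoℚ n = Data.Rational._/_ (Data.Integer.+ n) 1

module Submission where

-- Proposition 3.1. Let x̂ = WS(w) with w_j = 1/b_j and let r_j = f_j(x̂)/f_j(x̄) be the factor by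
-- which x̂ exceeds x̄ in objective j; every α with α ≥ r coordinatewise then makes x̂ α-approximate x̄.
--   (1) From Σ_j w_j f_j(x̂) ≤ σ Σ_j w_j f_j(x̄) some single term satisfies w_i f_i(x̂) ≤ σ w_i f_i(x̄),
--       that is r_i ≤ σ.
--   (2) From b_j ≤ f_j(x̄) ≤ (1+ε) b_j we get Σ_j r_j ≤ Σ_j w_j f_j(x̂) ≤ σ Σ_j w_j f_j(x̄) ≤ (1+ε)σp =: T.
--   (3) Redistribution: put α_j = max(1, r_j); this keeps Σ_{α_j>1} α_j ≤ Σ_j r_j ≤ T. The slack is
--       added to one coordinate k ≠ i, chosen with r_k > 1 when possible. If no such k exists, the sum
--       so far is at most r_i ≤ σ, and T > 1 + σ (because p ≥ 2 and ε > 0) lets α_k exceed 1 anyway.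
--       Coordinate i keeps α_i = max(1, r_i) ≤ σ.

module Lemmas where

  open import Defs
  open import Data.Nat using (ℕ; zero; suc)
  import Data.Integer as ℤ
  import Data.Integer.Solver as ℤSolver
  open import Data.Fin using (Fin; zero; suc; punchIn)
  import Data.Fin.Properties as FinP
  open import Data.Vec.Functional using (updateAt)
  open import Data.Vec.Functional.Properties using (updateAt-updates; updateAt-minimal)
  open import Data.Product using (∃; _×_; _,_)
  open import Data.Rational
  open import Data.Rational.Properties
  open import Data.Rational.Solver using (module +-*-Solver)
  import Data.Rational.Unnormalised as ℚᵘ
  import Data.Rational.Unnormalised.Properties as ℚᵘP
  open import Relation.Nullary using (¬_; yes; no; contradiction)
  open import Relation.Nullary.Decidable using (_×-dec_; ¬?)
  open import Relation.Binary.PropositionalEquality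

  sumFin-cong : ∀ p {g h : Fin p → ℚ} → (∀ j → g j ≡ h j) → sumFin p g ≡ sumFin p h
  sumFin-cong zero    g≡h = refl
  sumFin-cong (suc p) g≡h = cong₂ _+_ (g≡h zero) (sumFin-cong p (λ j → g≡h (suc j)))

  sumFin-mono : ∀ p {g h : Fin p → ℚ} → (∀ j → g j ≤ h j) → sumFin p g ≤ sumFin p h
  sumFin-mono zero    g≤h = ≤-refl
  sumFin-mono (suc p) g≤h = +-mono-≤ (g≤h zero) (sumFin-mono p (λ j → g≤h (suc j)))

  sumFin-mono-< : ∀ p {g h : Fin (suc p) → ℚ} → (∀ j → g j < h j) → sumFin (suc p) g < sumFin (suc p) h
  sumFin-mono-< p g<h = +-mono-<-≤ (g<h zero) (sumFin-mono p (λ j → <⇒≤ (g<h (suc j))))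

  sumFin-witness : ∀ p (g h : Fin (suc p) → ℚ) → sumFin (suc p) g ≤ sumFin (suc p) h → ∃ λ j → g j ≤ h j
  sumFin-witness p g h Σg≤Σh with FinP.any? (λ j → g j ≤? h j)
  ... | yes found = found
  ... | no  none  = contradiction (≤-<-trans Σg≤Σh Σh<Σg) (<-irrefl refl)
    where
    Σh<Σg : sumFin (suc p) h < sumFin (suc p) g
    Σh<Σg = sumFin-mono-< p (λ j → ≰⇒> (λ gj≤hj → none (j , gj≤hj)))

  sumFin-*ˡ : ∀ p c (g : Fin p → ℚ) → c * sumFin p g ≡ sumFin p (λ j → c * g j)
  sumFin-*ˡ zero    c g = *-zeroʳ c
  sumFin-*ˡ (suc p) c g = trans (*-distribˡ-+ c (g zero) _) (cong (c * g zero +_) (sumFin-*ˡ p c (λ j → g (suc j))))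

  ℕtoℚ-suc : ∀ n → ℕtoℚ (suc n) ≡ 1ℚ + ℕtoℚ n
  ℕtoℚ-suc n = begin
    ℕtoℚ (suc n)                 ≡⟨ fromℚᵘ-cong (ℚᵘP.≃-sym unnormalised) ⟩
    fromℚᵘ (toℚᵘ (1ℚ + ℕtoℚ n))  ≡⟨ fromℚᵘ-toℚᵘ (1ℚ + ℕtoℚ n) ⟩
    1ℚ + ℕtoℚ n                  ∎
    where
    open ≡-Reasoning
    open ℤSolver.+-*-Solver
    unnormalised : toℚᵘ (1ℚ + ℕtoℚ n) ℚᵘ.≃ ℚᵘ.mkℚᵘ (ℤ.+ suc n) 0
    unnormalised = ℚᵘP.≃-trans (toℚᵘ-homo-+ 1ℚ (ℕtoℚ n))
      (ℚᵘP.≃-trans (ℚᵘP.+-congʳ ℚᵘ.1ℚᵘ (toℚᵘ-fromℚᵘ (ℚᵘ.mkℚᵘ (ℤ.+ n) 0)))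
        (ℚᵘ.*≡* (solve 1 (λ m → (con (ℤ.+ 1) :* con (ℤ.+ 1) :+ m :* con (ℤ.+ 1)) :* con (ℤ.+ 1)
                             := (con (ℤ.+ 1) :+ m) :* (con (ℤ.+ 1) :* con (ℤ.+ 1))) refl (ℤ.+ n))))

  sumFin-const : ∀ p c → sumFin p (λ _ → c) ≡ c * ℕtoℚ p
  sumFin-const zero    c = sym (*-zeroʳ c)
  sumFin-const (suc p) c = begin
    c + sumFin p (λ _ → c)  ≡⟨ cong (c +_) (sumFin-const p c) ⟩
    c + c * ℕtoℚ p          ≡⟨ solve 2 (λ c n → c :+ c :* n := c :* (con 1ℚ :+ n)) refl c (ℕtoℚ p) ⟩
    c * (1ℚ + ℕtoℚ p)       ≡⟨ cong (c *_) (sym (ℕtoℚ-suc p)) ⟩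
    c * ℕtoℚ (suc p)        ∎
    where
    open ≡-Reasoning
    open +-*-Solver

  sumFin-replace : ∀ p (k : Fin p) (g h : Fin p → ℚ) → (∀ j → j ≢ k → g j ≡ h j) →
                   sumFin p h + g k ≡ sumFin p g + h k
  sumFin-replace (suc p) zero g h agree = begin
    h zero + tail h + g zero  ≡⟨ cong (λ t → h zero + t + g zero) (sumFin-cong p (λ j → sym (agree (suc j) (λ ())))) ⟩
    h zero + tail g + g zero  ≡⟨ solve 3 (λ a t c → a :+ t :+ c := c :+ t :+ a) refl (h zero) (tail g) (g zero) ⟩
    g zero + tail g + h zero  ∎
    where
    open ≡-Reasoning
    open +-*-Solver
    tail : (Fin (suc p) → ℚ) → ℚ
    tail g = sumFin p (λ j → g (suc j))
  sumFin-replace (suc p) (suc k) g h agree = begin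
    h zero + tail h + g (suc k)    ≡⟨ cong (λ a → a + tail h + g (suc k)) (sym (agree zero (λ ()))) ⟩
    g zero + tail h + g (suc k)    ≡⟨ +-assoc (g zero) (tail h) (g (suc k)) ⟩
    g zero + (tail h + g (suc k))  ≡⟨ cong (g zero +_) (sumFin-replace p k (λ j → g (suc j)) (λ j → h (suc j))
                                                          (λ j j≢k → agree (suc j) (λ sj≡sk → j≢k (FinP.suc-injective sj≡sk)))) ⟩
    g zero + (tail g + h (suc k))  ≡⟨ sym (+-assoc (g zero) (tail g) (h (suc k))) ⟩
    g zero + tail g + h (suc k)    ∎
    where
    open ≡-Reasoning
    tail : (Fin (suc p) → ℚ) → ℚ
    tail g = sumFin p (λ j → g (suc j))

  sumFin-single : ∀ p (i : Fin p) (g : Fin p → ℚ) → (∀ j → j ≢ i → g j ≡ 0ℚ) → sumFin p g ≡ g i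
  sumFin-single p i g vanish = begin
    sumFin p g                 ≡⟨ sym (+-identityʳ _) ⟩
    sumFin p g + 0ℚ            ≡⟨ sym (sumFin-replace p i g (λ _ → 0ℚ) vanish) ⟩
    sumFin p (λ _ → 0ℚ) + g i  ≡⟨ cong (_+ g i) (trans (sumFin-const p 0ℚ) (*-zeroˡ (ℕtoℚ p))) ⟩
    0ℚ + g i                   ≡⟨ +-identityˡ (g i) ⟩
    g i                        ∎
    where open ≡-Reasoning

  recip-pos : ∀ y (y>0 : 0ℚ < y) → 0ℚ < recip y y>0
  recip-pos y y>0 = positive⁻¹ _ {{1/pos⇒pos y {{positive y>0}}}}

  recip-cancel : ∀ x y (y>0 : 0ℚ < y) → x * recip y y>0 * y ≡ x
  recip-cancel x y y>0 = begin
    x * recip y y>0 * y    ≡⟨ *-assoc x (recip y y>0) y ⟩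
    x * (recip y y>0 * y)  ≡⟨ cong (x *_) (*-inverseˡ y {{pos⇒nonZero y {{positive y>0}}}}) ⟩
    x * 1ℚ                 ≡⟨ *-identityʳ x ⟩
    x                      ∎
    where open ≡-Reasoning

  *-nonNeg : ∀ {x y} → 0ℚ ≤ x → 0ℚ ≤ y → 0ℚ ≤ x * y
  *-nonNeg {x} {y} x≥0 y≥0 = nonNegative⁻¹ (x * y) {{nonNeg*nonNeg⇒nonNeg x {{nonNegative x≥0}} y {{nonNegative y≥0}}}}

  ≤-recip : ∀ {x z} y (y>0 : 0ℚ < y) → x ≤ z * y → x * recip y y>0 ≤ z
  ≤-recip {x} y y>0 x≤zy = *-cancelʳ-≤-pos y {{positive y>0}} (≤-trans (≤-reflexive (recip-cancel x y y>0)) x≤zy)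

  recip-antitone : ∀ {x b y} (b>0 : 0ℚ < b) (y>0 : 0ℚ < y) → 0ℚ ≤ x → b ≤ y → x * recip y y>0 ≤ x * recip b b>0
  recip-antitone {x} {b} {y} b>0 y>0 x≥0 b≤y = ≤-recip y y>0 (begin
    x                     ≡⟨ sym (recip-cancel x b b>0) ⟩
    x * recip b b>0 * b   ≤⟨ *-monoˡ-≤-nonNeg (x * recip b b>0) {{nonNegative x/b≥0}} b≤y ⟩
    x * recip b b>0 * y   ∎)
    where
    open ≤-Reasoning
    x/b≥0 : 0ℚ ≤ x * recip b b>0
    x/b≥0 = *-nonNeg x≥0 (<⇒≤ (recip-pos b b>0))

  slack≥0 : ∀ {D T} → D ≤ T → 0ℚ ≤ T - D
  slack≥0 {D} {T} D≤T = subst (_≤ T - D) (+-inverseʳ D) (+-monoˡ-≤ (- D) D≤T)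

  +-<⇒<-- : ∀ {x a y} → x + a < y → x < y - a
  +-<⇒<-- {x} {a} {y} x+a<y = subst (_< y - a) (solve 2 (λ x a → x :+ a :- a := x) refl x a) (+-monoˡ-< (- a) x+a<y)
    where open +-*-Solver

  target-exceeds : ∀ q {σ ε} → 1ℚ ≤ σ → 0ℚ < ε → 1ℚ + σ < (1ℚ + ε) * σ * ℕtoℚ (suc (suc q))
  target-exceeds q {σ} {ε} 1≤σ ε>0 = begin-strict
    1ℚ + σ                     ≤⟨ +-monoˡ-≤ σ 1≤σ ⟩
    σ + σ                      <⟨ +-mono-< σ<c σ<c ⟩
    c + c                      ≡⟨ sym (+-identityʳ (c + c)) ⟩
    c + c + 0ℚ                 ≤⟨ +-monoʳ-≤ (c + c) cQ≥0 ⟩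
    c + c + c * Q              ≡⟨ solve 2 (λ c Q → c :+ c :+ c :* Q := c :* (con 1ℚ :+ (con 1ℚ :+ Q))) refl c Q ⟩
    c * (1ℚ + (1ℚ + Q))        ≡⟨ cong (c *_) (sym (trans (ℕtoℚ-suc (suc q)) (cong (1ℚ +_) (ℕtoℚ-suc q)))) ⟩
    c * ℕtoℚ (suc (suc q))     ∎
    where
    open ≤-Reasoning
    open +-*-Solver
    c = (1ℚ + ε) * σ
    Q = ℕtoℚ q
    σ>0 : 0ℚ < σ
    σ>0 = <-≤-trans (positive⁻¹ 1ℚ) 1≤σ
    σ<c : σ < c
    σ<c = begin-strict
      σ               ≡⟨ sym (*-identityˡ σ) ⟩
      1ℚ * σ          <⟨ *-monoˡ-<-pos σ {{positive σ>0}} (subst (_< 1ℚ + ε) (+-identityʳ 1ℚ) (+-monoʳ-< 1ℚ ε>0)) ⟩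
      (1ℚ + ε) * σ    ∎
    cQ≥0 : 0ℚ ≤ c * Q
    cQ≥0 = *-nonNeg (<⇒≤ (<-trans σ>0 σ<c)) (nonNegative⁻¹ Q {{normalize-nonNeg q 1}})

  excess : ℚ → ℚ
  excess a with 1ℚ <? a
  ... | yes _ = a
  ... | no  _ = 0ℚ

  atLeast1 : ℚ → ℚ
  atLeast1 a with 1ℚ <? a
  ... | yes _ = a
  ... | no  _ = 1ℚ

  sumOver>1-excess : ∀ p (α : Fin p → ℚ) → sumOver>1 p α ≡ sumFin p (λ j → excess (α j))
  sumOver>1-excess zero    α = refl
  sumOver>1-excess (suc p) α with 1ℚ <? α zero
  ... | yes _ = cong (α zero +_) (sumOver>1-excess p (λ j → α (suc j)))
  ... | no  _ = cong (0ℚ +_) (sumOver>1-excess p (λ j → α (suc j)))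

  excess-> : ∀ {a} → 1ℚ < a → excess a ≡ a
  excess-> {a} 1<a with 1ℚ <? a
  ... | yes _   = refl
  ... | no  1≮a = contradiction 1<a 1≮a

  excess-≯ : ∀ {a} → ¬ 1ℚ < a → excess a ≡ 0ℚ
  excess-≯ {a} 1≮a with 1ℚ <? a
  ... | yes 1<a = contradiction 1<a 1≮a
  ... | no  _   = refl

  excess-≤ : ∀ {a s} → 0ℚ ≤ s → a ≤ s → excess a ≤ s
  excess-≤ {a} s≥0 a≤s with 1ℚ <? a
  ... | yes _ = a≤s
  ... | no  _ = s≥0

  excess-atLeast1 : ∀ a → excess (atLeast1 a) ≡ excess a
  excess-atLeast1 a with 1ℚ <? a
  ... | yes 1<a = excess-> 1<a
  ... | no  _   = excess-≯ (<-irrefl refl)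

  atLeast1-≥1 : ∀ a → 1ℚ ≤ atLeast1 a
  atLeast1-≥1 a with 1ℚ <? a
  ... | yes 1<a = <⇒≤ 1<a
  ... | no  _   = ≤-refl

  atLeast1-≥ : ∀ a → a ≤ atLeast1 a
  atLeast1-≥ a with 1ℚ <? a
  ... | yes _   = ≤-refl
  ... | no  1≮a = ≮⇒≥ 1≮a

  atLeast1-≤ : ∀ {a s} → 1ℚ ≤ s → a ≤ s → atLeast1 a ≤ s
  atLeast1-≤ {a} 1≤s a≤s with 1ℚ <? a
  ... | yes _ = a≤s
  ... | no  _ = 1≤s

  ≤-excess+ : ∀ {a δ} → 0ℚ ≤ δ → 1ℚ < excess a + δ → a ≤ excess a + δ
  ≤-excess+ {a} {δ} δ≥0 1<e+δ with 1ℚ <? a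
  ... | yes _   = subst (_≤ a + δ) (+-identityʳ a) (+-monoʳ-≤ a δ≥0)
  ... | no  1≮a = ≤-trans (≮⇒≥ 1≮a) (<⇒≤ 1<e+δ)

  excessSum : ∀ p → (Fin p → ℚ) → ℚ
  excessSum p r = sumFin p (λ j → excess (r j))

  updateAt-all : ∀ {n} {A : Set} (P : Fin n → A → Set) (xs : Fin n → A) (k : Fin n) (a : A) →
                 P k a → (∀ j → P j (xs j)) → ∀ j → P j (updateAt xs k (λ _ → a) j)
  updateAt-all P xs k a Pka Pxs j with j FinP.≟ k
  ... | yes refl = subst (P k) (sym (updateAt-updates k xs)) Pka
  ... | no  j≢k  = subst (P j) (sym (updateAt-minimal j k xs j≢k)) (Pxs j)

  bump : ∀ {p} → (Fin p → ℚ) → Fin p → ℚ → Fin p → ℚ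
  bump r k a = updateAt (λ j → atLeast1 (r j)) k (λ _ → a)

  sumOver>1-bump : ∀ p (r : Fin p → ℚ) k {a} → 1ℚ < a → sumOver>1 p (bump r k a) + excess (r k) ≡ excessSum p r + a
  sumOver>1-bump p r k {a} 1<a = begin
    sumOver>1 p (bump r k a) + excess (r k)                 ≡⟨ cong (_+ excess (r k)) (sumOver>1-excess p (bump r k a)) ⟩
    excessSum p (bump r k a) + excess (r k)                 ≡⟨ sumFin-replace p k (λ j → excess (r j)) (λ j → excess (bump r k a j)) unchanged ⟩
    excessSum p r + excess (bump r k a k)                   ≡⟨ cong (λ v → excessSum p r + excess v) (updateAt-updates k _) ⟩
    excessSum p r + excess a                                ≡⟨ cong (excessSum p r +_) (excess-> 1<a) ⟩
    excessSum p r + a                                       ∎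
    where
    open ≡-Reasoning
    unchanged : ∀ j → j ≢ k → excess (r j) ≡ excess (bump r k a j)
    unchanged j j≢k = sym (trans (cong excess (updateAt-minimal j k _ j≢k)) (excess-atLeast1 (r j)))

  absorb : ∀ p (r : Fin p → ℚ) (s T : ℚ) (i k : Fin p) → 1ℚ ≤ s → r i ≤ s → excessSum p r ≤ T → k ≢ i →
           1ℚ < excess (r k) + (T - excessSum p r) →
           ∃ λ α → (∀ j → 1ℚ ≤ α j) × (∀ j → r j ≤ α j) × α i ≤ s × sumOver>1 p α ≡ T
  absorb p r s T i k 1≤s ri≤s D≤T k≢i 1<a =
    bump r k a ,
    updateAt-all (λ _ v → 1ℚ ≤ v) _ k a (<⇒≤ 1<a) (λ j → atLeast1-≥1 (r j)) ,
    updateAt-all (λ j v → r j ≤ v) _ k a (≤-excess+ (slack≥0 D≤T) 1<a) (λ j → atLeast1-≥ (r j)) ,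
    subst (_≤ s) (sym (updateAt-minimal i k _ (λ i≡k → k≢i (sym i≡k)))) (atLeast1-≤ 1≤s ri≤s) ,
    slack-cancel (sumOver>1-bump p r k 1<a)
    where
    D = excessSum p r
    δ = T - D
    a = excess (r k) + δ
    slack-cancel : ∀ {S} → S + excess (r k) ≡ D + a → S ≡ T
    slack-cancel {S} eq = begin
      S                                ≡⟨ solve 2 (λ S c → S := S :+ c :- c) refl S (excess (r k)) ⟩
      S + excess (r k) - excess (r k)  ≡⟨ cong (_- excess (r k)) eq ⟩
      D + a - excess (r k)             ≡⟨ solve 3 (λ D c T → D :+ (c :+ (T :- D)) :- c := T) refl D (excess (r k)) T ⟩
      T                                ∎
      where
      open ≡-Reasoning
      open +-*-Solver

  -- A coordinate k ≠ i absorbing the slack exists: one with r k > 1 if there is one; otherwise only i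
  -- contributes, the sum is excess (r i) ≤ s, and the slack alone exceeds T − s > 1.
  absorbing-index : ∀ q (r : Fin (suc (suc q)) → ℚ) (s T : ℚ) (i : Fin (suc (suc q))) → 1ℚ ≤ s → r i ≤ s →
                    excessSum (suc (suc q)) r ≤ T → 1ℚ + s < T →
                    ∃ λ k → k ≢ i × 1ℚ < excess (r k) + (T - excessSum (suc (suc q)) r)
  absorbing-index q r s T i 1≤s ri≤s D≤T 1+s<T with FinP.any? (λ j → ¬? (j FinP.≟ i) ×-dec (1ℚ <? r j))
  ... | yes (k , k≢i , 1<rk) = k , k≢i , (begin-strict
    1ℚ                  <⟨ 1<rk ⟩
    r k                 ≡⟨ sym (excess-> 1<rk) ⟩
    excess (r k)        ≡⟨ sym (+-identityʳ _) ⟩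
    excess (r k) + 0ℚ   ≤⟨ +-monoʳ-≤ (excess (r k)) (slack≥0 D≤T) ⟩
    excess (r k) + δ    ∎)
    where
    open ≤-Reasoning
    D = excessSum (suc (suc q)) r
    δ = T - D
  ... | no  none = k , FinP.punchInᵢ≢i i zero , (begin-strict
    1ℚ                  <⟨ +-<⇒<-- (≤-<-trans (+-monoʳ-≤ 1ℚ D≤s) 1+s<T) ⟩
    δ                   ≡⟨ sym (+-identityˡ δ) ⟩
    0ℚ + δ              ≡⟨ cong (_+ δ) (sym (silent k (FinP.punchInᵢ≢i i zero))) ⟩
    excess (r k) + δ    ∎)
    where
    open ≤-Reasoning
    k = punchIn i zero
    D = excessSum (suc (suc q)) r
    δ = T - D
    silent : ∀ j → j ≢ i → excess (r j) ≡ 0ℚ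
    silent j j≢i = excess-≯ (λ 1<rj → none (j , j≢i , 1<rj))
    D≤s : D ≤ s
    D≤s = subst (_≤ s) (sym (sumFin-single _ i (λ j → excess (r j)) silent))
                (excess-≤ (≤-trans (nonNegative⁻¹ 1ℚ) 1≤s) ri≤s)

  redistribute : ∀ q (r : Fin (suc (suc q)) → ℚ) (s T : ℚ) (i : Fin (suc (suc q))) → 1ℚ ≤ s → r i ≤ s →
                 excessSum (suc (suc q)) r ≤ T → 1ℚ + s < T →
                 ∃ λ α → (∀ j → 1ℚ ≤ α j) × (∀ j → r j ≤ α j) × α i ≤ s × sumOver>1 (suc (suc q)) α ≡ T
  redistribute q r s T i 1≤s ri≤s D≤T 1+s<T =
    let (k , k≢i , 1<a) = absorbing-index q r s T i 1≤s ri≤s D≤T 1+s<T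
    in  absorb (suc (suc q)) r s T i k 1≤s ri≤s D≤T k≢i 1<a

  module ObjectiveRatios {X : Set} (n : ℕ) (f : X → Fin (suc n) → ℚ) (fpos : ∀ x j → 0ℚ < f x j)
                         (σ : ℚ) (1≤σ : 1ℚ ≤ σ) (WS : (Fin (suc n) → ℚ) → X) (ws : IsWSApprox (suc n) f σ WS)
                         (x̄ : X) (b : Fin (suc n) → ℚ) (ε : ℚ)
                         (b≤f : ∀ j → b j ≤ f x̄ j) (f≤b : ∀ j → f x̄ j ≤ (1ℚ + ε) * b j)
                         (bpos : ∀ j → 0ℚ < b j) where

    w : Fin (suc n) → ℚ
    w j = recip (b j) (bpos j)

    x̂ : X
    x̂ = WS w

    ratio : Fin (suc n) → ℚ
    ratio j = f x̂ j * recip (f x̄ j) (fpos x̄ j)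

    guarantee : weightedSum (suc n) f w x̂ ≤ σ * weightedSum (suc n) f w x̄
    guarantee = ws w (λ j → recip-pos (b j) (bpos j)) x̄

    dominating-approximates : ∀ α → (∀ j → ratio j ≤ α j) → Approximates (suc n) f α x̂ x̄
    dominating-approximates α ratio≤α j =
      subst (_≤ α j * f x̄ j) (recip-cancel (f x̂ j) (f x̄ j) (fpos x̄ j))
            (*-monoʳ-≤-nonNeg (f x̄ j) {{pos⇒nonNeg (f x̄ j) {{positive (fpos x̄ j)}}}} (ratio≤α j))

    some-ratio≤σ : ∃ λ i → ratio i ≤ σ
    some-ratio≤σ =
      let (i , wfx̂≤σwfx̄) = sumFin-witness n (λ j → w j * f x̂ j) (λ j → σ * (w j * f x̄ j))
                              (≤-trans guarantee (≤-reflexive (sumFin-*ˡ (suc n) σ (λ j → w j * f x̄ j))))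
      in  i , ≤-recip (f x̄ i) (fpos x̄ i) (*-cancelˡ-≤-pos (w i) {{positive (recip-pos (b i) (bpos i))}}
                (≤-trans wfx̂≤σwfx̄ (≤-reflexive (solve 3 (λ s w y → s :* (w :* y) := w :* (s :* y)) refl σ (w i) (f x̄ i)))))
      where open +-*-Solver

    excessSum-ratio≤ : excessSum (suc n) ratio ≤ (1ℚ + ε) * σ * ℕtoℚ (suc n)
    excessSum-ratio≤ = begin
      excessSum (suc n) ratio                      ≤⟨ sumFin-mono (suc n) (λ j → excess-≤ (ratio≥0 j) ≤-refl) ⟩
      sumFin (suc n) ratio                         ≤⟨ sumFin-mono (suc n) ratio≤wfx̂ ⟩
      weightedSum (suc n) f w x̂                    ≤⟨ guarantee ⟩
      σ * weightedSum (suc n) f w x̄                ≤⟨ *-monoˡ-≤-nonNeg σ {{nonNegative σ≥0}} (sumFin-mono (suc n) wfx̄≤1+ε) ⟩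
      σ * sumFin (suc n) (λ _ → 1ℚ + ε)            ≡⟨ cong (σ *_) (sumFin-const (suc n) (1ℚ + ε)) ⟩
      σ * ((1ℚ + ε) * ℕtoℚ (suc n))                ≡⟨ solve 3 (λ s e m → s :* (e :* m) := e :* s :* m) refl σ (1ℚ + ε) (ℕtoℚ (suc n)) ⟩
      (1ℚ + ε) * σ * ℕtoℚ (suc n)                  ∎
      where
      open ≤-Reasoning
      open +-*-Solver
      σ≥0 : 0ℚ ≤ σ
      σ≥0 = ≤-trans (nonNegative⁻¹ 1ℚ) 1≤σ
      fx̂≥0 : ∀ j → 0ℚ ≤ f x̂ j
      fx̂≥0 j = <⇒≤ (fpos x̂ j)
      ratio≥0 : ∀ j → 0ℚ ≤ ratio j
      ratio≥0 j = *-nonNeg (fx̂≥0 j) (<⇒≤ (recip-pos (f x̄ j) (fpos x̄ j)))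
      ratio≤wfx̂ : ∀ j → ratio j ≤ w j * f x̂ j
      ratio≤wfx̂ j = ≤-trans (recip-antitone (bpos j) (fpos x̄ j) (fx̂≥0 j) (b≤f j)) (≤-reflexive (*-comm (f x̂ j) (w j)))
      wfx̄≤1+ε : ∀ j → w j * f x̄ j ≤ 1ℚ + ε
      wfx̄≤1+ε j = subst (_≤ 1ℚ + ε) (*-comm (f x̄ j) (w j)) (≤-recip (b j) (bpos j) (f≤b j))

open Lemmas

open import Defs
open import Data.Nat using (ℕ; _≤_; zero; suc; s≤s)
open import Data.Fin using (Fin)
open import Data.Product using (Σ; ∃; _×_; _,_)
open import Data.Rational using (ℚ; 0ℚ; 1ℚ; _+_; _*_; _<_)
open import Data.Rational using () renaming (_≤_ to _≤ℚ_)
open import Relation.Binary.PropositionalEquality using (_≡_)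

proposition3p1 :
    (p : ℕ) → 2 ≤ p →
    (X : Set) → (f : X → Fin p → ℚ) → (∀ x j → 0ℚ < f x j) →
    (σ : ℚ) → 1ℚ ≤ℚ σ →
    (WS : (Fin p → ℚ) → X) → IsWSApprox p f σ WS →
    (x̄ : X) → (b : Fin p → ℚ) → (ε : ℚ) → 0ℚ < ε →
    (∀ j → b j ≤ℚ f x̄ j) → (∀ j → f x̄ j ≤ℚ (1ℚ + ε) * b j) →
    (bpos : ∀ j → 0ℚ < b j) →
    Σ (Fin p → ℚ) (λ α →
      (∀ j → 1ℚ ≤ℚ α j) ×
      Approximates p f α (WS (λ j → recip (b j) (bpos j))) x̄ ×
      ∃ (λ i → α i ≤ℚ σ) ×
      sumOver>1 p α ≡ (1ℚ + ε) * σ * ℕtoℚ p)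
proposition3p1 zero () X f fpos σ 1≤σ WS ws x̄ b ε ε>0 b≤f f≤b bpos
proposition3p1 (suc zero) (s≤s ()) X f fpos σ 1≤σ WS ws x̄ b ε ε>0 b≤f f≤b bpos
proposition3p1 (suc (suc q)) _ X f fpos σ 1≤σ WS ws x̄ b ε ε>0 b≤f f≤b bpos =
  let (i , ratio-i≤σ) = some-ratio≤σ
      (α , α≥1 , ratio≤α , αi≤σ , Σα≡T) =
        redistribute q ratio σ _ i 1≤σ ratio-i≤σ excessSum-ratio≤ (target-exceeds q 1≤σ ε>0)
  in  α , α≥1 , dominating-approximates α ratio≤α , (i , αi≤σ) , Σα≡T
  where open ObjectiveRatios (suc q) f fpos σ 1≤σ WS ws x̄ b ε b≤f f≤b bpos
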